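{- Let $\mathcal F$ be a union-closed family over the universe $[n]$ with density $k$. Then $0\le k\le n-1$.
   Context: A family $\mathcal F$ of subsets of $[n]$ is union-closed over the universe $[n]$ if $[n]\in\mathcal F$ and $A\cup B\in\mathcal F$ for all $A,B\in\mathcal F$. Convention: the empty set is never a member of any family considered; $2^{[n]}$ denotes the family of all nonempty subsets of $[n]$. The closure of a union-closed $\mathcal F$ is $\overline{\mathcal F}=\{A\in 2^{[n]}:\ \mathcal F\cup\{A\}\text{ is union-closed}\}$. Iterated closures: $\overline{\mathcal F}^{(0)}=\mathcal F$ and $\overline{\mathcal F}^{(i)}=\overline{\overline{\mathcal F}^{(i-1)}}$ for $i\ge1$. $\mathcal F$ is $k$-dense (has density $k$) if $k$ is the smallest nonnegative integer with $\overline{\mathcal F}^{(k)}=2^{[n]}$. -}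

module Defs where

open import Data.Nat using (ℕ; zero; suc; _<_)
open import Data.Fin.Subset using (Subset; ⊤; _∪_; Nonempty)
open import Data.Product using (_×_)
open import Data.Sum using (_⊎_)
open import Relation.Binary.PropositionalEquality using (_≡_)
open import Relation.Nullary using (¬_)

Family : ℕ → Set₁
Family n = Subset n → Set

-- 2^[n]: all NONEMPTY subsets of [n]
Full : (n : ℕ) → Family n
Full n A = Nonempty A

insert : ∀ {n} → Family n → Subset n → Family n
insert F A B = F B ⊎ B ≡ A

UnionClosed : ∀ {n} → Family n → Set
UnionClosed {n} F =
  (∀ A → F A → Nonempty A) ×
  F ⊤ ×
  (∀ A B → F A → F B → F (A ∪ B))

closure : ∀ {n} → Family n → Family n
closure F A = Nonempty A × UnionClosed (insert F A)

iterClosure : ∀ {n} → ℕ → Family n → Family n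
iterClosure zero F = F
iterClosure (suc i) F = closure (iterClosure i F)

SameFamily : ∀ {n} → Family n → Family n → Set
SameFamily F G = ∀ A → (F A → G A) × (G A → F A)

IsDense : ∀ {n} → Family n → ℕ → Set
IsDense {n} F k =
  SameFamily (iterClosure k F) (Full n) ×
  (∀ j → j < k → ¬ SameFamily (iterClosure j F) (Full n))

module Submission where

-- Say that G contains the large sets above m (ContainsLarge m G)
-- if every A with m ≤ ∣A∣ lies in G.  A union-closed F over [n] always
-- contains ⊤, the only set of size n.  The closure operator lowers this threshold by one:
-- a nonempty A may be added to a union-closed G as soon as every union A ∪ C
-- with C ∈ G is A itself or already in G (closure-intro), and A ∪ C is
-- either A or a proper superset of A, hence of larger size.  So if G holds
-- all sets of size ≥ m + 2, its closure holds all sets of size ≥ m + 1.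
-- Since the closure of a union-closed family is again union-closed
-- (closure-unionClosed), after n - 1 closures every nonempty set is present,
-- i.e. the (n-1)-st closure is 2^[n], and minimality of the density gives
-- k ≤ n - 1.  (For n = 0 there is no union-closed family: ⊤ is empty.)

open import Defs
open import Data.Nat using (ℕ; zero; suc; _+_; _∸_; _≤_; z≤n; s≤s)
open import Data.Nat.Properties using (≤-antisym; ≤-trans; <-irrefl; +-suc; +-identityʳ; ≮⇒≥)
open import Data.Product using (_,_; proj₁; _×_)
open import Data.Sum using (_⊎_; inj₁; inj₂)
open import Data.Empty using (⊥-elim)
open import Relation.Nullary using (yes; no)
open import Relation.Binary.PropositionalEquality using (_≡_; refl; sym; trans; cong; subst)
open import Data.Fin.Subset using (Subset; ⊤; _∪_; Nonempty; ∣_∣; _∈_; _⊆_; _⊂_)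
  renaming (⊥ to ∅)
open import Data.Fin.Subset.Properties
  using ( ∪-assoc; ∪-comm; ∪-idem; p⊆p∪q; q⊆p∪q; x∈p∪q⁺; x∈p∪q⁻; ⊆-antisym; ⊆-trans
        ; _∈?_; _⊂?_; nonempty?; Empty-unique; ∣⊥∣≡0; ∣p∣≤n; ∣p∣≡n⇒p≡⊤
        ; x∈p⇒∣p-x∣<∣p∣; p⊂q⇒∣p∣<∣q∣ )

private
  variable
    n : ℕ
    G : Family n
    A B C : Subset n

⊆⇒∪≡ : B ⊆ A → A ∪ B ≡ A
⊆⇒∪≡ {B = B} {A = A} B⊆A = ⊆-antisym A∪B⊆A (p⊆p∪q B)
  where
  A∪B⊆A : A ∪ B ⊆ A
  A∪B⊆A {x} x∈A∪B with x∈p∪q⁻ A B x∈A∪B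
  ... | inj₁ x∈A = x∈A
  ... | inj₂ x∈B = B⊆A x∈B

∪≡⇒⊆ : A ∪ B ≡ A → B ⊆ A
∪≡⇒⊆ {A = A} A∪B≡A x∈B = subst (_ ∈_) A∪B≡A (q⊆p∪q A _ x∈B)

absorbed-or-grows : ∀ (A C : Subset n) → C ⊆ A ⊎ A ⊂ A ∪ C
absorbed-or-grows A C with A ⊂? A ∪ C
... | yes A⊂A∪C = inj₂ A⊂A∪C
... | no A⊄A∪C = inj₁ C⊆A
  where
  C⊆A : C ⊆ A
  C⊆A {x} x∈C with x ∈? A
  ... | yes x∈A = x∈A
  ... | no x∉A = ⊥-elim (A⊄A∪C (p⊆p∪q C , x , x∈p∪q⁺ (inj₂ x∈C) , x∉A))

nonempty⇒size : Nonempty A → 1 ≤ ∣ A ∣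
nonempty⇒size (x , x∈A) = ≤-trans (s≤s z≤n) (x∈p⇒∣p-x∣<∣p∣ x∈A)

size⇒nonempty : ∀ (A : Subset n) → 1 ≤ ∣ A ∣ → Nonempty A
size⇒nonempty {n} A 1≤∣A∣ with nonempty? A
... | yes neA = neA
... | no ¬neA = ⊥-elim (<-irrefl refl (subst (1 ≤_) (∣⊥∣≡0 n) 1≤∣∅∣))
  where
  1≤∣∅∣ : 1 ≤ ∣ ∅ {n} ∣
  1≤∣∅∣ = subst (λ S → 1 ≤ ∣ S ∣) (Empty-unique ¬neA) 1≤∣A∣

closure-intro : UnionClosed G → Nonempty A →
                (∀ C → G C → insert G A (A ∪ C)) → closure G A
closure-intro {G = G} {A = A} (nonempty , top , union) neA absorbs =
  neA , nonempty′ , inj₁ top , union′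
  where
  nonempty′ : ∀ X → insert G A X → Nonempty X
  nonempty′ X (inj₁ gX) = nonempty X gX
  nonempty′ X (inj₂ refl) = neA

  union′ : ∀ X Y → insert G A X → insert G A Y → insert G A (X ∪ Y)
  union′ X Y (inj₁ gX) (inj₁ gY) = inj₁ (union X Y gX gY)
  union′ X Y (inj₂ refl) (inj₂ refl) = inj₂ (∪-idem X)
  union′ X Y (inj₂ refl) (inj₁ gY) = absorbs Y gY
  union′ X Y (inj₁ gX) (inj₂ refl) = subst (insert G A) (∪-comm Y X) (absorbs X gX)

closure-absorbs : closure G A → G C → insert G A (A ∪ C)
closure-absorbs (_ , _ , _ , union) gC = union _ _ (inj₂ refl) (inj₁ gC)

⊆-closure : UnionClosed G → G A → closure G A
⊆-closure uc@(nonempty , _ , union) gA =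
  closure-intro uc (nonempty _ gA) (λ C gC → inj₁ (union _ C gA gC))

-- If A and B absorb G, so does A ∪ B: either B ∪ C = B, or B ∪ C ∈ G and
-- then A ∪ (B ∪ C) is in G or equals A, in which case C ⊆ A.
closure-∪ : UnionClosed G → closure G A → closure G B → closure G (A ∪ B)
closure-∪ {G = G} {A = A} {B = B} uc clA@((x , x∈A) , _) clB =
  closure-intro uc (x , x∈p∪q⁺ (inj₁ x∈A)) absorbs
  where
  absorbs : ∀ C → G C → insert G (A ∪ B) ((A ∪ B) ∪ C)
  absorbs C gC with closure-absorbs clB gC
  ... | inj₂ B∪C≡B = inj₂ (trans (∪-assoc A B C) (cong (A ∪_) B∪C≡B))
  ... | inj₁ gB∪C with closure-absorbs clA gB∪C
  ...   | inj₁ gA∪B∪C = inj₁ (subst G (sym (∪-assoc A B C)) gA∪B∪C)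
  ...   | inj₂ A∪B∪C≡A = inj₂ (⊆⇒∪≡ (⊆-trans C⊆A (p⊆p∪q B)))
    where
    C⊆A : C ⊆ A
    C⊆A = ⊆-trans (q⊆p∪q B C) (∪≡⇒⊆ A∪B∪C≡A)

closure-unionClosed : UnionClosed G → UnionClosed (closure G)
closure-unionClosed uc@(_ , top , _) =
  (λ _ → proj₁) , ⊆-closure uc top , λ _ _ → closure-∪ uc

iterClosure-unionClosed : ∀ i → UnionClosed G → UnionClosed (iterClosure i G)
iterClosure-unionClosed zero uc = uc
iterClosure-unionClosed (suc i) uc = closure-unionClosed (iterClosure-unionClosed i uc)

ContainsLarge : ℕ → Family n → Set
ContainsLarge m G = ∀ A → m ≤ ∣ A ∣ → G A

-- ⊤ is the only subset of [n] of size n, so a family containing ⊤ contains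
-- all sets of size at least n.
universe-containsLarge : ∀ {n} {G : Family n} → G ⊤ → ContainsLarge n G
universe-containsLarge {G = G} top A n≤∣A∣ =
  subst G (sym (∣p∣≡n⇒p≡⊤ (≤-antisym (∣p∣≤n A) n≤∣A∣))) top

supersets⇒closure : UnionClosed G → Nonempty A → (∀ B → A ⊂ B → G B) → closure G A
supersets⇒closure {G = G} {A = A} uc neA supersets = closure-intro uc neA absorbs
  where
  absorbs : ∀ C → G C → insert G A (A ∪ C)
  absorbs C _ with absorbed-or-grows A C
  ... | inj₁ C⊆A = inj₂ (⊆⇒∪≡ C⊆A)
  ... | inj₂ A⊂A∪C = inj₁ (supersets (A ∪ C) A⊂A∪C)

closure-containsLarge : ∀ {m} → UnionClosed G →
  ContainsLarge (suc (suc m)) G → ContainsLarge (suc m) (closure G)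
closure-containsLarge uc large A m<∣A∣ =
  supersets⇒closure uc (size⇒nonempty A (≤-trans (s≤s z≤n) m<∣A∣))
    (λ B A⊂B → large B (≤-trans (s≤s m<∣A∣) (p⊂q⇒∣p∣<∣q∣ A⊂B)))

iterClosure-containsLarge : ∀ i m → UnionClosed G →
  ContainsLarge (suc m + i) G → ContainsLarge (suc m) (iterClosure i G)
iterClosure-containsLarge zero m uc large =
  subst (λ t → ContainsLarge (suc t) _) (+-identityʳ m) large
iterClosure-containsLarge {G = G} (suc i) m uc large =
  closure-containsLarge (iterClosure-unionClosed i uc)
    (iterClosure-containsLarge i (suc m) uc
      (subst (λ t → ContainsLarge (suc t) G) (+-suc m i) large))

containsLarge⇒full : ∀ {n} {G : Family n} →
  UnionClosed G → ContainsLarge 1 G → SameFamily G (Full n)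
containsLarge⇒full (nonempty , _ , _) large A =
  nonempty A , λ neA → large A (nonempty⇒size neA)

density-minimal : ∀ {n} {F : Family n} {k} j →
  IsDense F k → SameFamily (iterClosure j F) (Full n) → k ≤ j
density-minimal j (_ , minimal) full = ≮⇒≥ (λ j<k → minimal j j<k full)

lemma3 : (n : ℕ) (F : Family n) (k : ℕ) →
    UnionClosed F → IsDense F k → 0 ≤ k × k ≤ n ∸ 1
lemma3 zero F k (nonempty , top , _) _ with nonempty ⊤ top
... | () , _
lemma3 (suc n) F k uc@(_ , top , _) dense = z≤n , density-minimal n dense full
  where
  full : SameFamily (iterClosure n F) (Full (suc n))
  full = containsLarge⇒full (iterClosure-unionClosed n uc)
           (iterClosure-containsLarge n 0 uc (universe-containsLarge top))
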